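{- Let $\mathfrak{M}=(D,X,H)$ be a supervaluation structure, $\Phi$ an admissibility condition, $Y_f\in{\sf Adm}_\mathfrak{M}$, $g\in Y_f$, and $Y^{g\le}_f:=\{h\in Y_f: g\le h\}$. If $\Phi(g)\cap Y_f\neq\emptyset$, then $\theta(Y_f,g)=\theta(Y^{g\le}_f,g)$.
   Context: Basic setting: $\mathcal{L}$ is a first-order language with constants, function symbols, predicates, identity and primitive logical symbols $\neg,\wedge,\rightarrow,\forall$. A k-interpretation over $D\neq\emptyset$ interprets constants and function symbols classically and each $n$-ary predicate $P$ by a pair of disjoint sets $(I^+(P),I^-(P))$ of $n$-tuples; $I\le J$ iff $I^\pm(P)\subseteq J^\pm(P)$ for all $P$. A supervaluation structure $\mathfrak{M}=(D,X,H)$ consists of $D\ne\emptyset$, a set $X$ of k-interpretations agreeing on constants and function symbols, and a reflexive transitive $H\subseteq X\times X$ with $(I,J)\in H\Rightarrow I\le J$. Truth at an interpretation is given by the strong Kleene clauses for atoms/negated atoms (positive/negative extensions), classical identity, $\neg\neg$, $\wedge$, $\neg\wedge$, $\forall$, $\neg\forall$ (evaluated at the same interpretation), the clause: $\psi\rightarrow\chi$ is true at $J$ iff for all $J'$ with $(J,J')\in H$, if $\psi$ is true at $J'$ then $\chi$ is true at $J'$; and the clause: $\neg(\psi\rightarrow\chi)$ is true at $J$ iff $\psi$ and $\neg\chi$ are true at $J$. Truth structures: $\mathcal{L}$ contains a syntax theory, every element of $D$ is named by a constant, and syntactic formulas are bivalent and evaluated identically at all $J\in X$. $\mathcal{L}_{\mathrm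 T}$ is $\mathcal{L}$ plus a unary predicate $\mathrm T$; sentences of $\mathcal{L}_{\mathrm T}$ are identified with their codes in $D$, and ${\sf Sent}$ is the set of $\mathcal{L}_{\mathrm T}$-sentences. A valuation is a function $f:X\to\mathcal{P}({\sf Sent})$; ${\sf Val}_\mathfrak{M}$ is the set of valuations, and $f\le g$ iff $f(J)\subseteq g(J)$ for all $J\in X$. A valuation $f$ is basic iff (i) for no $J$ and $\varphi$ are both $\varphi,\neg\varphi\in f(J)$; (ii) for every $\mathcal{L}$-sentence $\varphi$ and $J\in X$, $\varphi\in f(J)$ implies $\mathfrak{M},J\Vdash\varphi$; (iii) $(J,J')\in H$ implies $f(J)\subseteq f(J')$. $\mathcal{B}_\mathfrak{M}$ is the set of basic valuations. An admissibility condition is a function $\Phi:{\sf Val}_\mathfrak{M}\to\mathcal{P}(\mathcal{B}_\mathfrak{M})$ such that $\Phi(f)=\emptyset$ if $f\notin\mathcal{B}_\mathfrak{M}$; if $f\le g$ and $f\in\mathcal{B}_\mathfrak{M}$ then $\Phi(g)\subseteq\Phi(f)$; and $g\in\Phi(f)$ implies $f\le g$. Write $f\le_\Phi g$ iff $g\in\Phi(f)$. For $J\in X$ and $f\in\mathcal{B}_\mathfrak{M}$, the truth interpretation $J_f$ agrees with $J$ on $\mathcal{L}$ and interprets $\mathrm T$ with positive extension $f(J)$ and negative extension $\{\varphi:\neg\varphi\in f(J)\}$. $(I_f,J_g)\in H_\Phi$ iff $(I,J)\in H$ and $f\le_\Phi g$. For $Y\subseteq\mathcal{B}_\mathfrak{M}$,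 the truth structure $(D,X\times Y,H_\Phi)$ has the truth interpretations $J_f$ ($J\in X,f\in Y$) with $H_\Phi$ restricted to $X\times Y$; truth at $J_f$ is defined by the same clauses, the conditional quantifying over $J'_g\in X\times Y$ with $(J_f,J'_g)\in H_\Phi$. A set $Y\subseteq\mathcal{B}_\mathfrak{M}$ is grounded if it has an element $f$ with $f\le g$ for all $g\in Y$ and $Y\cap\Phi(f)\ne\emptyset$; such a set is written $Y_f$, and ${\sf Adm}_\mathfrak{M}$ is the set of grounded sets. For $g\in Y\subseteq\mathcal{B}_\mathfrak{M}$, $\theta(Y,g)$ is the valuation $J\mapsto\{\varphi\in{\sf Sent}:(D,X\times Y,H_\Phi),J_g\Vdash\varphi\}$. -}

module Defs where

open import Level using (Level; Lift; lift; 0ℓ) renaming (suc to lsuc)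
open import Data.Nat using (ℕ; zero; suc)
open import Data.Fin using (Fin; zero; suc)
open import Data.Vec using (Vec; []; _∷_)
open import Data.Product using (Σ; _×_; _,_)
open import Data.Sum using (_⊎_)
open import Data.Empty using (⊥)
open import Data.Unit using (⊤)
open import Relation.Nullary using (¬_)
open import Relation.Binary.PropositionalEquality using (_≡_)

-- The base language L: constants, function symbols, predicates.
-- 'Syntactic' marks the predicates belonging to the syntax theory.

record Signature : Set₁ where
  field
    Const     : Set
    Func      : ℕ → Set
    Pred      : ℕ → Set
    Syntactic : ∀ {k} → Pred k → Set

module Syntax (S : Signature) where
  open Signature S

  data Term (n : ℕ) : Set where
    var : Fin n → Term n
    con : Const → Term n
    app : ∀ {k} → Func k → Vec (Term n) k → Term n

  infixr 6 _∧'_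
  infixr 5 _⇒'_
  infix 7 _≐_

  data Formula (n : ℕ) : Set where
    atom  : ∀ {k} → Pred k → Vec (Term n) k → Formula n
    T     : Term n → Formula n
    _≐_   : Term n → Term n → Formula n
    ¬'_   : Formula n → Formula n
    _∧'_  : Formula n → Formula n → Formula n
    _⇒'_  : Formula n → Formula n → Formula n
    ∀'_   : Formula (suc n) → Formula n

  Sentence : Set
  Sentence = Formula 0

  IsL : ∀ {n} → Formula n → Set
  IsL (atom P ts) = ⊤
  IsL (T t)       = ⊥
  IsL (t ≐ u)     = ⊤
  IsL (¬' φ)      = IsL φ
  IsL (φ ∧' ψ)    = IsL φ × IsL ψ
  IsL (φ ⇒' ψ)    = IsL φ × IsL ψ
  IsL (∀' φ)      = IsL φ

-- Strong Kleene / Kripke-conditional semantics over a frame of worlds.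
-- Tr w s φ : φ is true at w under s ;  Fa w s φ : ¬φ is true at w under s.

module Semantics (S : Signature) (D : Set)
                 (constI : Signature.Const S → D)
                 (funcI : ∀ {k} → Signature.Func S k → Vec D k → D) where
  open Signature S
  open Syntax S

  extend : ∀ {n} → (Fin n → D) → D → Fin (suc n) → D
  extend s d zero    = d
  extend s d (suc i) = s i

  empty : Fin 0 → D
  empty ()

  mutual
    ⟦_⟧ : ∀ {n} → Term n → (Fin n → D) → D
    ⟦ var i ⟧    s = s i
    ⟦ con c ⟧    s = constI c
    ⟦ app F ts ⟧ s = funcI F (⟦ ts ⟧* s)

    ⟦_⟧* : ∀ {n k} → Vec (Term n) k → (Fin n → D) → Vec D k
    ⟦ [] ⟧*     s = []
    ⟦ t ∷ ts ⟧* s = ⟦ t ⟧ s ∷ ⟦ ts ⟧* s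

  module Sat {a : Level} (W : Set a) (R : W → W → Set a)
             (pos neg : W → ∀ {k} → Pred k → Vec D k → Set a)
             (Tpos Tneg : W → D → Set a) where
    mutual
      Tr : ∀ {n} → W → (Fin n → D) → Formula n → Set a
      Tr w s (atom P ts) = pos w P (⟦ ts ⟧* s)
      Tr w s (T t)       = Tpos w (⟦ t ⟧ s)
      Tr w s (t ≐ u)     = Lift a (⟦ t ⟧ s ≡ ⟦ u ⟧ s)
      Tr w s (¬' φ)      = Fa w s φ
      Tr w s (φ ∧' ψ)    = Tr w s φ × Tr w s ψ
      Tr w s (φ ⇒' ψ)    = ∀ w' → R w w' → Tr w' s φ → Tr w' s ψ
      Tr w s (∀' φ)      = (d : D) → Tr w (extend s d) φ

      Fa : ∀ {n} → W → (Fin n → D) → Formula n → Set a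
      Fa w s (atom P ts) = neg w P (⟦ ts ⟧* s)
      Fa w s (T t)       = Tneg w (⟦ t ⟧ s)
      Fa w s (t ≐ u)     = Lift a (¬ (⟦ t ⟧ s ≡ ⟦ u ⟧ s))
      Fa w s (¬' φ)      = Tr w s φ
      Fa w s (φ ∧' ψ)    = Fa w s φ ⊎ Fa w s ψ
      Fa w s (φ ⇒' ψ)    = Tr w s φ × Fa w s ψ
      Fa w s (∀' φ)      = Σ D (λ d → Fa w (extend s d) φ)

    _⊩_ : W → Formula 0 → Set a
    w ⊩ φ = Tr w empty φ

-- Supervaluation structures (D, X, H).  X is given as an index set of
-- k-interpretations, all sharing the interpretation of constants and
-- function symbols.

record SVS (S : Signature) : Set₁ where
  open Signature S
  field
    D         : Set
    inhabited : D
    constI    : Const → D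
    funcI     : ∀ {k} → Func k → Vec D k → D
    X         : Set
    pos neg   : X → ∀ {k} → Pred k → Vec D k → Set
    disjoint  : ∀ J {k} (P : Pred k) v → pos J P v → neg J P v → ⊥
    H         : X → X → Set
    H-refl    : ∀ J → H J J
    H-trans   : ∀ {I J K} → H I J → H J K → H I K
    H-≤       : ∀ {I J} → H I J → ∀ {k} (P : Pred k) v →
                (pos I P v → pos J P v) × (neg I P v → neg J P v)

record TruthStructure (S : Signature) (M : SVS S) : Set₁ where
  open Signature S
  open SVS M
  open Syntax S
  field
    named      : ∀ d → Σ Const (λ c → constI c ≡ d)
    code       : Sentence → D
    code-inj   : ∀ φ ψ → code φ ≡ code ψ → φ ≡ ψ
    syn-bival  : ∀ J {k} (P : Pred k) v → Syntactic P → pos J P v ⊎ neg J P v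
    syn-const  : ∀ J J' {k} (P : Pred k) v → Syntactic P →
                 (pos J P v → pos J' P v) × (neg J P v → neg J' P v)

module TruthTheory (S : Signature) (M : SVS S) (TS : TruthStructure S M) where
  open Signature S
  open SVS M
  open TruthStructure TS
  open Syntax S
  open Semantics S D constI funcI

  -- truth in the supervaluation structure M (for L-sentences; T is
  -- interpreted as empty here, which is irrelevant for L-sentences)
  module Base = Sat X H pos neg (λ _ _ → ⊥) (λ _ _ → ⊥)

  _⊩M_ : X → Sentence → Set
  J ⊩M φ = J Base.⊩ φ

  Valuation : Set₁
  Valuation = X → Sentence → Set

  VSet : Set₁
  VSet = Valuation → Set

  _≤v_ : Valuation → Valuation → Set
  f ≤v g = ∀ J φ → f J φ → g J φ

  ≤v-refl : ∀ f → f ≤v f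
  ≤v-refl f J φ p = p

  record Basic (f : Valuation) : Set where
    field
      consistent : ∀ J φ → f J φ → f J (¬' φ) → ⊥
      sound      : ∀ J φ → IsL φ → f J φ → J ⊩M φ
      monotone   : ∀ J J' → H J J' → ∀ φ → f J φ → f J' φ

  -- Φ f g  means  g ∈ Φ(f)  (i.e. f ≤_Φ g)
  record AdmCond : Set₁ where
    field
      Φ        : Valuation → Valuation → Set
      Φ-basic  : ∀ f g → Φ f g → Basic g
      Φ-nonB   : ∀ f g → ¬ Basic f → ¬ Φ f g
      Φ-anti   : ∀ f g h → f ≤v g → Basic f → Φ g h → Φ f h
      Φ-≤      : ∀ f g → Φ f g → f ≤v g

  module _ (A : AdmCond) where
    open AdmCond A

    -- worlds of the truth structure (D, X × Y, H_Φ): pairs J_g, g ∈ Y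
    record TWorld (Y : VSet) : Set₁ where
      constructor ⟨_,_,_⟩
      field
        wJ : X
        wg : Valuation
        wY : Y wg

    open TWorld

    module TS (Y : VSet) = Sat (TWorld Y)
      (λ w w' → Lift (lsuc 0ℓ) (H (wJ w) (wJ w') × Φ (wg w) (wg w')))
      (λ w P v → Lift (lsuc 0ℓ) (pos (wJ w) P v))
      (λ w P v → Lift (lsuc 0ℓ) (neg (wJ w) P v))
      (λ w d → Lift (lsuc 0ℓ) (Σ Sentence (λ φ → code φ ≡ d × wg w (wJ w) φ)))
      (λ w d → Lift (lsuc 0ℓ) (Σ Sentence (λ φ → code φ ≡ d × wg w (wJ w) (¬' φ))))

    record Grounded (Y : VSet) (f : Valuation) : Set₁ where
      field
        Y-basic : ∀ g → Y g → Basic g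
        f∈Y     : Y f
        f-least : ∀ g → Y g → f ≤v g
        Y∩Φf    : Σ Valuation (λ h → Y h × Φ f h)

    θ : (Y : VSet) (g : Valuation) → Y g → X → Sentence → Set₁
    θ Y g g∈Y J φ = TS._⊩_ Y ⟨ J , g , g∈Y ⟩ φ

    Above : VSet → Valuation → VSet
    Above Y g h = Y h × (g ≤v h)

  _≅θ_ : (X → Sentence → Set₁) → (X → Sentence → Set₁) → Set₁
  θ₁ ≅θ θ₂ = ∀ J φ → (θ₁ J φ → θ₂ J φ) × (θ₂ J φ → θ₁ J φ)

-- Every world of the truth structure accessible from J_h with g ≤ h is again of the form J'_h'
-- with g ≤ h', because f ≤_Φ h' implies f ≤ h'. So the worlds above g form a generated
-- subframe of (D, X × Y_f, H_Φ). The clauses of truth and falsity at a world only look at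
-- that world and at worlds accessible from it, so truth at J_g is the same in the whole
-- structure and in the restricted one.
module Submission where

open import Defs
open import Data.Product using (Σ; _×_; _,_)
open import Data.Sum using (inj₁; inj₂)
open import Data.Fin using (Fin)
open import Level using (lift)

module _ (S : Signature) (M : SVS S) (TS : TruthStructure S M) where
  open SVS M
  open Syntax S
  open TruthTheory S M TS
  open Semantics S D constI funcI using (extend)

  ≤v-trans : ∀ {f g h} → f ≤v g → g ≤v h → f ≤v h
  ≤v-trans f≤g g≤h J φ p = g≤h J φ (f≤g J φ p)

  module _ (A : AdmCond) where
    open AdmCond A
    open TWorld

    Restrict : VSet → (Valuation → Set) → VSet
    Restrict Y P h = Y h × P h

    restrict : ∀ {Y P} (w : TWorld A Y) → P (wg w) → TWorld A (Restrict Y P)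
    restrict ⟨ J , h , y ⟩ p = ⟨ J , h , (y , p) ⟩

    ≤v-Φ-closed : ∀ g {h h'} → Φ h h' → g ≤v h → g ≤v h'
    ≤v-Φ-closed g h≤Φh' g≤h = ≤v-trans g≤h (Φ-≤ _ _ h≤Φh')

    module RestrictionInvariance (Y : VSet) (P : Valuation → Set)
                                 (P-Φ-closed : ∀ {h h'} → Φ h h' → P h → P h') where
      private
        YP = Restrict Y P

      mutual
        Tr-restrict : ∀ {n} (w : TWorld A Y) (p : P (wg w)) (s : Fin n → D) φ →
                      TS.Tr A Y w s φ → TS.Tr A YP (restrict w p) s φ
        Tr-restrict w p s (atom _ _) x = x
        Tr-restrict w p s (T _) x = x
        Tr-restrict w p s (_ ≐ _) x = x
        Tr-restrict w p s (¬' φ) x = Fa-restrict w p s φ x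
        Tr-restrict w p s (φ ∧' ψ) (x , y) = Tr-restrict w p s φ x , Tr-restrict w p s ψ y
        Tr-restrict w p s (φ ⇒' ψ) x ⟨ J' , h' , (y' , p') ⟩ r z =
          Tr-restrict w' p' s ψ (x w' r (Tr-unrestrict w' p' s φ z))
          where w' = ⟨ J' , h' , y' ⟩
        Tr-restrict w p s (∀' φ) x d = Tr-restrict w p (extend s d) φ (x d)

        Fa-restrict : ∀ {n} (w : TWorld A Y) (p : P (wg w)) (s : Fin n → D) φ →
                      TS.Fa A Y w s φ → TS.Fa A YP (restrict w p) s φ
        Fa-restrict w p s (atom _ _) x = x
        Fa-restrict w p s (T _) x = x
        Fa-restrict w p s (_ ≐ _) x = x
        Fa-restrict w p s (¬' φ) x = Tr-restrict w p s φ x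
        Fa-restrict w p s (φ ∧' ψ) (inj₁ x) = inj₁ (Fa-restrict w p s φ x)
        Fa-restrict w p s (φ ∧' ψ) (inj₂ y) = inj₂ (Fa-restrict w p s ψ y)
        Fa-restrict w p s (φ ⇒' ψ) (x , y) = Tr-restrict w p s φ x , Fa-restrict w p s ψ y
        Fa-restrict w p s (∀' φ) (d , x) = d , Fa-restrict w p (extend s d) φ x

        Tr-unrestrict : ∀ {n} (w : TWorld A Y) (p : P (wg w)) (s : Fin n → D) φ →
                        TS.Tr A YP (restrict w p) s φ → TS.Tr A Y w s φ
        Tr-unrestrict w p s (atom _ _) x = x
        Tr-unrestrict w p s (T _) x = x
        Tr-unrestrict w p s (_ ≐ _) x = x
        Tr-unrestrict w p s (¬' φ) x = Fa-unrestrict w p s φ x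
        Tr-unrestrict w p s (φ ∧' ψ) (x , y) = Tr-unrestrict w p s φ x , Tr-unrestrict w p s ψ y
        Tr-unrestrict w p s (φ ⇒' ψ) x w' r@(lift (_ , h≤Φh')) z =
          Tr-unrestrict w' p' s ψ (x (restrict w' p') r (Tr-restrict w' p' s φ z))
          where p' = P-Φ-closed h≤Φh' p
        Tr-unrestrict w p s (∀' φ) x d = Tr-unrestrict w p (extend s d) φ (x d)

        Fa-unrestrict : ∀ {n} (w : TWorld A Y) (p : P (wg w)) (s : Fin n → D) φ →
                        TS.Fa A YP (restrict w p) s φ → TS.Fa A Y w s φ
        Fa-unrestrict w p s (atom _ _) x = x
        Fa-unrestrict w p s (T _) x = x
        Fa-unrestrict w p s (_ ≐ _) x = x
        Fa-unrestrict w p s (¬' φ) x = Tr-unrestrict w p s φ x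
        Fa-unrestrict w p s (φ ∧' ψ) (inj₁ x) = inj₁ (Fa-unrestrict w p s φ x)
        Fa-unrestrict w p s (φ ∧' ψ) (inj₂ y) = inj₂ (Fa-unrestrict w p s ψ y)
        Fa-unrestrict w p s (φ ⇒' ψ) (x , y) = Tr-unrestrict w p s φ x , Fa-unrestrict w p s ψ y
        Fa-unrestrict w p s (∀' φ) (d , x) = d , Fa-unrestrict w p (extend s d) φ x

    θ-Above : ∀ Y g (g∈Y : Y g) → θ A Y g g∈Y ≅θ θ A (Above A Y g) g (g∈Y , ≤v-refl g)
    θ-Above Y g g∈Y J φ =
      Tr-restrict w (≤v-refl g) _ φ , Tr-unrestrict w (≤v-refl g) _ φ
      where
        open RestrictionInvariance Y (g ≤v_) (≤v-Φ-closed g)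
        w = ⟨ J , g , g∈Y ⟩

lemma6 : (S : Signature) (M : SVS S) (TS : TruthStructure S M) →
    let open TruthTheory S M TS in
    (A : AdmCond) (Y : VSet) (f : Valuation) → Grounded A Y f →
    (g : Valuation) (g∈Y : Y g) →
    Σ Valuation (λ h → AdmCond.Φ A g h × Y h) →
    θ A Y g g∈Y ≅θ θ A (Above A Y g) g (g∈Y , ≤v-refl g)
lemma6 S M TS A Y _ _ g g∈Y _ = θ-Above S M TS A Y g g∈Y
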